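{- Let $n > k \geq 0$ be integers with $k \geq \lfloor n/2 \rfloor$. Then $\mathrm{rank}_{\mathbb{B}}(D_{n,k}) = \mathrm{rank}_{\mathrm{bin}}(D_{n,k}) = n$.
   Context: $D_{n,k}$ is the $n\times n$ circulant $0,1$ matrix whose first row consists of $n-k$ consecutive ones followed by $k$ zeros, and each subsequent row is the cyclic shift of the preceding row by one position to the right. For a $0,1$ matrix $M$ of size $n\times m$: the binary rank $\mathrm{rank}_{\mathrm{bin}}(M)$ is the minimal $d$ such that $M=A\cdot B$ with $A$ a $0,1$ matrix of size $n\times d$, $B$ a $0,1$ matrix of size $d\times m$, and the product computed over the integers (equivalently, the minimum number of pairwise disjoint all-ones submatrices partitioning the $1$-entries of $M$); the Boolean rank $\mathrm{rank}_{\mathbb{B}}(M)$ is defined the same way but with Boolean arithmetic ($1+1=1$), equivalently the minimum number of all-ones submatrices covering the $1$-entries of $M$. -}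

module Defs where

open import Data.Nat using (ℕ; zero; suc; _+_; _*_; _∸_; _≤_; _<_; _≤ᵇ_; _<ᵇ_)
open import Data.Nat.Properties using ()
open import Data.Bool using (Bool; true; false; _∧_; _∨_; if_then_else_)
open import Data.Fin using (Fin; toℕ)
open import Data.Product using (Σ; ∃; _×_; _,_)
open import Relation.Binary.PropositionalEquality using (_≡_)

Mat01 : ℕ → ℕ → Set
Mat01 n m = Fin n → Fin m → Bool

bit : Bool → ℕ
bit true  = 1
bit false = 0

sumFin : (d : ℕ) → (Fin d → ℕ) → ℕ
sumFin zero    f = 0
sumFin (suc d) f = f Fin.zero + sumFin d (λ l → f (Fin.suc l))

orFin : (d : ℕ) → (Fin d → Bool) → Bool
orFin zero    f = false
orFin (suc d) f = f Fin.zero ∨ orFin d (λ l → f (Fin.suc l))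

cycOffset : {n : ℕ} → Fin n → Fin n → ℕ
cycOffset {n} i j = if toℕ i ≤ᵇ toℕ j then toℕ j ∸ toℕ i else (n + toℕ j) ∸ toℕ i

-- D_{n,k}: circulant matrix whose first row is n-k ones followed by k zeros,
-- each row the cyclic right shift of the previous: entry (i,j) = 1 iff
-- (j - i) mod n < n - k.
D : (n k : ℕ) → Mat01 n n
D n k i j = cycOffset i j <ᵇ (n ∸ k)

BinFactorization : {n m : ℕ} → Mat01 n m → ℕ → Set
BinFactorization {n} {m} M d =
  Σ (Mat01 n d) λ A → Σ (Mat01 d m) λ B →
    ∀ i j → bit (M i j) ≡ sumFin d (λ l → bit (A i l) * bit (B l j))

BoolFactorization : {n m : ℕ} → Mat01 n m → ℕ → Set
BoolFactorization {n} {m} M d =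
  Σ (Mat01 n d) λ A → Σ (Mat01 d m) λ B →
    ∀ i j → M i j ≡ orFin d (λ l → A i l ∧ B l j)

BinaryRank : {n m : ℕ} → Mat01 n m → ℕ → Set
BinaryRank M r = BinFactorization M r × (∀ d → BinFactorization M d → r ≤ d)

BooleanRank : {n m : ℕ} → Mat01 n m → ℕ → Set
BooleanRank M r = BoolFactorization M r × (∀ d → BoolFactorization M d → r ≤ d)

{-# OPTIONS --safe #-}
-- The diagonal of D_{n,k} is a fooling set: two distinct positions i, j of
-- Z/n have cyclic offsets (j - i) + (i - j) = n, and when n ≤ 2k + 1 these
-- cannot both be smaller than the width n - k of the band of ones.  So no
-- all-ones rectangle contains two diagonal entries, and every cover, a fortiori
-- every partition, of the ones of D_{n,k} uses at least n rectangles.  The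
-- trivial factorization D = I · D shows that n suffice.
module Submission where

open import Defs
open import Data.Bool using (Bool; true; false; _∧_; _∨_)
open import Data.Bool.Properties using (∨-identityʳ; T-≡)
open import Data.Empty using (⊥; ⊥-elim)
open import Data.Fin as Fin using (Fin; toℕ)
open import Data.Fin.Properties using (toℕ-injective; toℕ<n; injective⇒≤)
open import Data.Nat using (ℕ; zero; suc; _+_; _*_; _∸_; _/_; _%_; _<_; _≤_; _≤ᵇ_; _≡ᵇ_; s≤s⁻¹)
open import Data.Nat.DivMod using (m≡m%n+[m/n]*n; m%n<n)
open import Data.Nat.Properties
open import Data.Nat.Tactic.RingSolver using (solve-∀)
open import Data.Product using (∃; _×_; _,_; proj₁)
open import Function using (_∘_; id)
open import Function.Bundles using (Equivalence)
open import Relation.Binary.Definitions using (tri<; tri≈; tri>)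
open import Relation.Binary.PropositionalEquality
open import Relation.Nullary using (yes; no; contradiction)
open import Relation.Nullary.Reflects using (ofʸ)

private
  variable
    n m d f : ℕ

orFin-true⇒∃ : ∀ d (g : Fin d → Bool) → orFin d g ≡ true → ∃ λ l → g l ≡ true
orFin-true⇒∃ (suc d) g eq with g Fin.zero in g0
... | true  = Fin.zero , g0
... | false = let l , gl = orFin-true⇒∃ d (g ∘ Fin.suc) eq in Fin.suc l , gl

∃⇒orFin-true : ∀ d (g : Fin d → Bool) l → g l ≡ true → orFin d g ≡ true
∃⇒orFin-true (suc d) g Fin.zero    gl rewrite gl = refl
∃⇒orFin-true (suc d) g (Fin.suc l) gl with g Fin.zero
... | true  = refl
... | false = ∃⇒orFin-true d (g ∘ Fin.suc) l gl

orFin-false : ∀ d → orFin d (λ _ → false) ≡ false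
orFin-false zero    = refl
orFin-false (suc d) = orFin-false d

sumFin-≢0⇒∃ : ∀ d (h : Fin d → ℕ) → sumFin d h ≢ 0 → ∃ λ l → h l ≢ 0
sumFin-≢0⇒∃ zero    h ne = ⊥-elim (ne refl)
sumFin-≢0⇒∃ (suc d) h ne with h Fin.zero ≟ 0
... | no h0≢0 = Fin.zero , h0≢0
... | yes h0≡0 =
  let l , hl = sumFin-≢0⇒∃ d (h ∘ Fin.suc) (ne ∘ cong₂ _+_ h0≡0) in Fin.suc l , hl

term≤sumFin : ∀ d (h : Fin d → ℕ) l → h l ≤ sumFin d h
term≤sumFin (suc d) h Fin.zero    = m≤m+n _ _
term≤sumFin (suc d) h (Fin.suc l) = ≤-trans (term≤sumFin d (h ∘ Fin.suc) l) (m≤n+m _ _)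

sumFin-0 : ∀ d → sumFin d (λ _ → 0) ≡ 0
sumFin-0 zero    = refl
sumFin-0 (suc d) = sumFin-0 d

∧≡true⇒ : ∀ {x y} → x ∧ y ≡ true → x ≡ true × y ≡ true
∧≡true⇒ {true} {true} _ = refl , refl

bit*bit≢0⇒ : ∀ x y → bit x * bit y ≢ 0 → x ≡ true × y ≡ true
bit*bit≢0⇒ true  true  _  = refl , refl
bit*bit≢0⇒ true  false ne = ⊥-elim (ne refl)
bit*bit≢0⇒ false _     ne = ⊥-elim (ne refl)

1≤bit⇒true : ∀ {x} → 1 ≤ bit x → x ≡ true
1≤bit⇒true {true} _ = refl

identity : Mat01 n n
identity i j = toℕ i ≡ᵇ toℕ j

orFin-identity : ∀ d (i : Fin d) (g : Fin d → Bool) →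
                 orFin d (λ l → identity i l ∧ g l) ≡ g i
orFin-identity (suc d) Fin.zero    g =
  trans (cong (g Fin.zero ∨_) (orFin-false d)) (∨-identityʳ _)
orFin-identity (suc d) (Fin.suc i) g = orFin-identity d i (g ∘ Fin.suc)

sumFin-identity : ∀ d (i : Fin d) (g : Fin d → Bool) →
                  sumFin d (λ l → bit (identity i l) * bit (g l)) ≡ bit (g i)
sumFin-identity (suc d) Fin.zero    g
  rewrite sumFin-0 d | +-identityʳ (bit (g Fin.zero)) = +-identityʳ _
sumFin-identity (suc d) (Fin.suc i) g = sumFin-identity d i (g ∘ Fin.suc)

identityBoolFactorization : (M : Mat01 n m) → BoolFactorization M n
identityBoolFactorization {n} M =
  identity , M , λ i j → sym (orFin-identity n i (λ l → M l j))

identityBinFactorization : (M : Mat01 n m) → BinFactorization M n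
identityBinFactorization {n} M =
  identity , M , λ i j → sym (sumFin-identity n i (λ l → M l j))

record RectangleCover (M : Mat01 n m) (A : Mat01 n d) (B : Mat01 d m) : Set where
  field
    covers : ∀ {i j} → M i j ≡ true → ∃ λ l → A i l ≡ true × B l j ≡ true
    inside : ∀ {i j} l → A i l ≡ true → B l j ≡ true → M i j ≡ true

boolFactorization⇒cover : {M : Mat01 n m} {A : Mat01 n d} {B : Mat01 d m} →
  (∀ i j → M i j ≡ orFin d (λ l → A i l ∧ B l j)) → RectangleCover M A B
boolFactorization⇒cover {d = d} M≡A·B = record
  { covers = λ {i} {j} Mij →
      let l , ABl = orFin-true⇒∃ d _ (trans (sym (M≡A·B i j)) Mij) in l , ∧≡true⇒ ABl
  ; inside = λ {i} {j} l Ail Blj →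
      trans (M≡A·B i j) (∃⇒orFin-true d _ l (cong₂ _∧_ Ail Blj))
  }

binFactorization⇒cover : {M : Mat01 n m} {A : Mat01 n d} {B : Mat01 d m} →
  (∀ i j → bit (M i j) ≡ sumFin d (λ l → bit (A i l) * bit (B l j))) → RectangleCover M A B
binFactorization⇒cover {d = d} {M = M} {A} {B} M≡A·B = record
  { covers = λ {i} {j} Mij →
      let l , ABl≢0 = sumFin-≢0⇒∃ d _ (λ A·B≡0 →
                        1+n≢0 (trans (cong bit (sym Mij)) (trans (M≡A·B i j) A·B≡0)))
      in l , bit*bit≢0⇒ (A i l) (B l j) ABl≢0
  ; inside = λ {i} {j} l Ail Blj → 1≤bit⇒true (begin
      1                                           ≡⟨ cong₂ (λ x y → bit x * bit y) Ail Blj ⟨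
      bit (A i l) * bit (B l j)                   ≤⟨ term≤sumFin d _ l ⟩
      sumFin d (λ l → bit (A i l) * bit (B l j))  ≡⟨ M≡A·B i j ⟨
      bit (M i j)                                 ∎)
  }
  where open ≤-Reasoning

record FoolingSet (M : Mat01 n m) (f : ℕ) : Set where
  field
    row   : Fin f → Fin n
    col   : Fin f → Fin m
    ones  : ∀ s → M (row s) (col s) ≡ true
    fools : ∀ {s t} → M (row s) (col t) ≡ true → M (row t) (col s) ≡ true → s ≡ t

foolingSet≤cover : {M : Mat01 n m} {A : Mat01 n d} {B : Mat01 d m} →
  FoolingSet M f → RectangleCover M A B → f ≤ d
foolingSet≤cover {A = A} {B} F C = injective⇒≤ rectangle-injective
  where
  open FoolingSet F
  open RectangleCover C
  rectangle : ∀ s → ∃ λ l → A (row s) l ≡ true × B l (col s) ≡ true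
  rectangle s = covers (ones s)
  rectangle-injective : ∀ {s t} → proj₁ (rectangle s) ≡ proj₁ (rectangle t) → s ≡ t
  rectangle-injective {s} {t} same
    with l , As , Bs ← rectangle s | _ , At , Bt ← rectangle t
    = fools (inside l As (subst (λ l → B l (col t) ≡ true) (sym same) Bt))
            (inside l (subst (λ l → A (row t) l ≡ true) (sym same) At) Bs)

foolingSet⇒BooleanRank : {M : Mat01 n m} → FoolingSet M n → BooleanRank M n
foolingSet⇒BooleanRank {M = M} F =
  identityBoolFactorization M , λ d (A , B , M≡A·B) →
    foolingSet≤cover F (boolFactorization⇒cover {A = A} {B} M≡A·B)

foolingSet⇒BinaryRank : {M : Mat01 n m} → FoolingSet M n → BinaryRank M n
foolingSet⇒BinaryRank {M = M} F =
  identityBinFactorization M , λ d (A , B , M≡A·B) →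
    foolingSet≤cover F (binFactorization⇒cover {A = A} {B} M≡A·B)

n/2≤k⇒n≤1+k*2 : ∀ n {k} → n / 2 ≤ k → n ≤ suc (k * 2)
n/2≤k⇒n≤1+k*2 n {k} n/2≤k = begin
  n                  ≡⟨ m≡m%n+[m/n]*n n 2 ⟩
  n % 2 + n / 2 * 2  ≤⟨ +-mono-≤ (s≤s⁻¹ (m%n<n n 2)) (*-monoˡ-≤ 2 n/2≤k) ⟩
  suc (k * 2)        ∎
  where open ≤-Reasoning

cycOffset-≤ : (i j : Fin n) → toℕ i ≤ toℕ j → cycOffset i j ≡ toℕ j ∸ toℕ i
cycOffset-≤ i j i≤j with toℕ i ≤ᵇ toℕ j | ≤⇒≤ᵇ i≤j
... | true | _ = refl

cycOffset-> : (i j : Fin n) → toℕ j < toℕ i → cycOffset i j ≡ n + toℕ j ∸ toℕ i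
cycOffset-> i j j<i with toℕ i ≤ᵇ toℕ j | ≤ᵇ-reflects-≤ (toℕ i) (toℕ j)
... | false | _        = refl
... | true  | ofʸ i≤j = contradiction i≤j (<⇒≱ j<i)

cycOffset-diag : (i : Fin n) → cycOffset i i ≡ 0
cycOffset-diag i = trans (cycOffset-≤ i i ≤-refl) (n∸n≡0 (toℕ i))

[y∸x]+[n+x∸y]≡n : ∀ {n x y} → x ≤ y → y ≤ n → (y ∸ x) + (n + x ∸ y) ≡ n
[y∸x]+[n+x∸y]≡n {n} {x} {y} x≤y y≤n = begin
  t + (n + x ∸ y)        ≡⟨ cong (λ y → t + (n + x ∸ y)) (m+[n∸m]≡n x≤y) ⟨
  t + (n + x ∸ (x + t))  ≡⟨ cong (λ z → t + (z ∸ (x + t))) (+-comm n x) ⟩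
  t + (x + n ∸ (x + t))  ≡⟨ cong (t +_) ([m+n]∸[m+o]≡n∸o x n t) ⟩
  t + (n ∸ t)            ≡⟨ m+[n∸m]≡n (≤-trans (m∸n≤m y x) y≤n) ⟩
  n                      ∎
  where
  open ≡-Reasoning
  t = y ∸ x

cycOffset[i,j]+cycOffset[j,i]≡n : {i j : Fin n} → i ≢ j → cycOffset i j + cycOffset j i ≡ n
cycOffset[i,j]+cycOffset[j,i]≡n {n} {i} {j} i≢j with <-cmp (toℕ i) (toℕ j)
... | tri< i<j _ _ = trans (cong₂ _+_ (cycOffset-≤ i j (<⇒≤ i<j)) (cycOffset-> j i i<j))
                           ([y∸x]+[n+x∸y]≡n (<⇒≤ i<j) (<⇒≤ (toℕ<n j)))
... | tri≈ _ i≡j _ = ⊥-elim (i≢j (toℕ-injective i≡j))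
... | tri> _ _ j<i = trans (+-comm (cycOffset i j) _)
                      (trans (cong₂ _+_ (cycOffset-≤ j i (<⇒≤ j<i)) (cycOffset-> i j j<i))
                             ([y∸x]+[n+x∸y]≡n (<⇒≤ j<i) (<⇒≤ (toℕ<n i))))

offsets-outside-band : ∀ {n k a b} → k < n → n ≤ suc (k * 2) →
                       a + b ≡ n → a < n ∸ k → b < n ∸ k → ⊥
offsets-outside-band {k = k} {a} {b} k<n n≤1+k*2 refl a<n∸k b<n∸k =
  <⇒≱ (+-cancelˡ-≤ (a + b) _ _ (begin
    a + b + suc (suc (k * 2))  ≡⟨ rearrange a b k ⟩
    (suc a + k) + (suc b + k)  ≤⟨ +-mono-≤ (m≤o∸n⇒m+n≤o (suc a) (<⇒≤ k<n) a<n∸k)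
                                           (m≤o∸n⇒m+n≤o (suc b) (<⇒≤ k<n) b<n∸k) ⟩
    a + b + (a + b)            ∎)) n≤1+k*2
  where
  open ≤-Reasoning
  rearrange : ∀ a b k → a + b + suc (suc (k * 2)) ≡ (suc a + k) + (suc b + k)
  rearrange = solve-∀

D-diagonal : ∀ {n k} → k < n → (i : Fin n) → D n k i i ≡ true
D-diagonal k<n i rewrite cycOffset-diag i =
  Equivalence.to T-≡ (<⇒<ᵇ (m<n⇒0<n∸m k<n))

D-antisymmetric : ∀ {n k} → k < n → n ≤ suc (k * 2) →
                  {i j : Fin n} → D n k i j ≡ true → D n k j i ≡ true → i ≡ j
D-antisymmetric k<n n≤1+k*2 {i} {j} Dij Dji with i Fin.≟ j
... | yes i≡j = i≡j
... | no  i≢j = ⊥-elim (offsets-outside-band k<n n≤1+k*2 (cycOffset[i,j]+cycOffset[j,i]≡n i≢j)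
                          (<ᵇ⇒< _ _ (Equivalence.from T-≡ Dij))
                          (<ᵇ⇒< _ _ (Equivalence.from T-≡ Dji)))

D-diagonalFoolingSet : ∀ {n k} → k < n → n ≤ suc (k * 2) → FoolingSet (D n k) n
D-diagonalFoolingSet k<n n≤1+k*2 = record
  { row   = id
  ; col   = id
  ; ones  = D-diagonal k<n
  ; fools = D-antisymmetric k<n n≤1+k*2
  }

mainTheorem2 : (n k : ℕ) → k < n → n / 2 ≤ k →
    BooleanRank (D n k) n × BinaryRank (D n k) n
mainTheorem2 n k k<n n/2≤k =
  foolingSet⇒BooleanRank diagonal , foolingSet⇒BinaryRank diagonal
  where
  diagonal : FoolingSet (D n k) n
  diagonal = D-diagonalFoolingSet k<n (n/2≤k⇒n≤1+k*2 n n/2≤k)
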